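{- Let $P$ be a valid PBP of $T$ with following position $i$, let $j\in\{1,\dots,n\}$ and $\ell\ge1$ be such that $P\cdot\langle j,\ell\rangle$ is a valid PBP. For a position $x\in\{1,\dots,n\}$: if $\mathit{source}(P,x)\notin\{i,i+1,\dots,i+\ell-1\}$, then $\mathit{source}(P,x)=\mathit{source}(P\cdot\langle j,\ell\rangle,x)$; otherwise $\mathit{source}(P\cdot\langle j,\ell\rangle,x')=\mathit{source}(P\cdot\langle j,\ell\rangle,x)$, where $x'=\mathit{source}(P,x)$.
   Context: Let $T=T[1]\cdots T[n]$ be a string over an ordered alphabet $\Sigma$ (elements regarded as distinct from integers). A partial bidirectional parse (PBP) of $T$ is a sequence of phrases $f_1,\dots,f_k$ partitioning a prefix $T[1..m]$, with $f_x=T[s_x..s_x+|f_x|-1]$, $s_1=1$, $s_{x+1}=s_x+|f_x|$; each phrase is a character phrase ($|f_x|=1$, storing $T[s_x]$) or a target phrase $\langle t_x,|f_x|\rangle$ with $t_x\in\{1,\dots,n\}$, $t_x\ne s_x$, $t_x+|f_x|-1\le n$, $T[t_x..t_x+|f_x|-1]=T[s_x..s_x+|f_x|-1]$. The position following $P$ is $i=m+1$. $B_P$ is $P$ followed by character phrases $T[m+1],\dots,T[n]$. For $B_P$ define $g^0(x)=T[x]$ if $x$ lies in a character phrase and $g^0(x)=t_p+(x-s_p)$ if $x$ lies in target phrase $f_p$; $g^k(x)=g^{k-1}(x)$ if $g^{k-1}(x)\in\Sigma$, else $g^k(x)=g^0(g^{k-1}(x))$. $P$ is valid if $g^n(x)\in\Sigma$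 for all $x$. $P\cdot\langle j,\ell\rangle$ appends the target phrase $\langle j,\ell\rangle$ covering $T[i..i+\ell-1]$. For a valid PBP $P$ and position $x$, $\mathit{source}(P,x)$ is the position $y$ with either $g^0(x)\in\Sigma$ and $y=x$, or $g^k(x)=y$ and $g^{k+1}(x)\in\Sigma$ for some $k\ge0$ (computed in $B_P$). -}

module Defs where

open import Data.Nat using (ℕ; zero; suc; _+_; _∸_; _≤_; _<_; _≤?_; _<?_)
open import Data.Nat.Properties using (_≟_)
open import Data.List using (List; []; _∷_; _++_; [_])
open import Data.Sum using (_⊎_; inj₁; inj₂)
open import Data.Product using (_×_; Σ; ∃-syntax; _,_)
open import Data.Unit using (⊤)
open import Data.Empty using (⊥)
open import Data.Bool using (if_then_else_; _∧_)
open import Relation.Nullary using (¬_; does)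
open import Relation.Binary.PropositionalEquality using (_≡_)

-- Positions are 1-based natural numbers; the text T[1..n] is a function
-- ℕ → A of which only the values at 1..n matter.
-- A phrase: a character phrase (length 1, its character is T[s]) or a
-- target phrase ⟨t, len⟩.
data Phrase : Set where
  chr : Phrase
  tgt : (t len : ℕ) → Phrase

module _ {A : Set} (n : ℕ) (T : ℕ → A) where

  nextPos : ℕ → List Phrase → ℕ
  nextPos s [] = s
  nextPos s (chr ∷ ps) = nextPos (suc s) ps
  nextPos s (tgt t len ∷ ps) = nextPos (s + len) ps

  follow : List Phrase → ℕ
  follow P = nextPos 1 P

  -- well-formedness of phrases starting at position s (partition of a prefix
  -- T[1..m] with m ≤ n, target phrase conditions)
  WF : ℕ → List Phrase → Set
  WF s [] = s ≤ suc n
  WF s (chr ∷ ps) = WF (suc s) ps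
  WF s (tgt t len ∷ ps) =
    1 ≤ len × 1 ≤ t × ¬ (t ≡ s) × t + len ∸ 1 ≤ n
    × (∀ k → k < len → T (t + k) ≡ T (s + k))
    × WF (s + len) ps

  IsPBP : List Phrase → Set
  IsPBP P = WF 1 P

  -- g^0 in B_P (phrases after the prefix are character phrases),
  -- phrases starting at position s
  g0-from : ℕ → List Phrase → ℕ → A ⊎ ℕ
  g0-from s [] x = inj₁ (T x)
  g0-from s (chr ∷ ps) x =
    if does (x ≟ s) then inj₁ (T x) else g0-from (suc s) ps x
  g0-from s (tgt t len ∷ ps) x =
    if does (s ≤? x) ∧ does (x <? s + len)
    then inj₂ (t + (x ∸ s))
    else g0-from (s + len) ps x

  g0 : List Phrase → ℕ → A ⊎ ℕ
  g0 P x = g0-from 1 P x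

  g : List Phrase → ℕ → ℕ → A ⊎ ℕ
  g P zero x = g0 P x
  g P (suc k) x with g P k x
  ... | inj₁ c = inj₁ c
  ... | inj₂ y = g0 P y

  IsChar : A ⊎ ℕ → Set
  IsChar (inj₁ _) = ⊤
  IsChar (inj₂ _) = ⊥

  Valid : List Phrase → Set
  Valid P = IsPBP P × (∀ x → 1 ≤ x → x ≤ n → IsChar (g P n x))

  -- source(P,x) = y  (as a relation; it is functional)
  Source : List Phrase → ℕ → ℕ → Set
  Source P x y =
    (IsChar (g0 P x) × y ≡ x)
    ⊎ (∃[ k ] (g P k x ≡ inj₂ y × IsChar (g P (suc k) x)))

  append : List Phrase → ℕ → ℕ → List Phrase
  append P j ℓ = P ++ [ tgt j ℓ ]

module Submission where

-- Appending ⟨j,ℓ⟩ changes g⁰ only on the new phrase [i, i+ℓ), where P had character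
-- phrases.  Hence every pointer of P points to the left of i and survives, so each
-- chain x ↦ g⁰ x ↦ … of P is also a chain of P·⟨j,ℓ⟩.  If the chain stops at y outside
-- the new phrase it still stops there; if y lies in the new phrase, y is now itself
-- a pointer, the chain of P·⟨j,ℓ⟩ runs on through y, and x and y share their sources.

open import Defs
open import Data.Nat using (ℕ; zero; suc; _+_; _∸_; _≤_; _<_; _≤?_; _<?_; z≤n)
open import Data.Nat.Properties
  using (_≟_; ≤-refl; ≤-trans; <-≤-trans; <-cmp; m∸n+n≡m; m≤m+n; n≤1+n; ≮⇒≥;
         <⇒≢; >⇒≢; <⇒≱; ≤⇒≯)
open import Data.Product using (_×_; _,_)
open import Data.Sum using (_⊎_; inj₁; inj₂)
open import Data.List using (List; []; _∷_; _++_; [_])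
open import Data.List.Properties using (++-identityʳ)
open import Data.Bool.Properties using (∧-zeroʳ)
open import Data.Unit using (tt)
open import Data.Empty using (⊥-elim)
open import Relation.Nullary using (¬_; yes; no; does)
open import Relation.Nullary.Decidable using (dec-true; dec-false)
open import Relation.Binary.PropositionalEquality
  using (_≡_; refl; sym; trans; cong; subst; module ≡-Reasoning)
open import Relation.Binary.Definitions using (tri<; tri≈; tri>)
open import Function.Base using (id)
open import Function.Bundles using (_⇔_; mk⇔)

module _ {A : Set} (n : ℕ) (T : ℕ → A) where

  private
    IC = IsChar n T

  s≤nextPos : ∀ s P → s ≤ nextPos n T s P
  s≤nextPos s [] = ≤-refl
  s≤nextPos s (chr ∷ ps) = ≤-trans (n≤1+n s) (s≤nextPos (suc s) ps)
  s≤nextPos s (tgt t len ∷ ps) = ≤-trans (m≤m+n s len) (s≤nextPos (s + len) ps)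

  -- The tests `does (x ≟ s)` in g0-from normalise to `x ≡ᵇ s`, which `with x ≟ s` does
  -- not abstract; so the branches are selected by rewriting with dec-true/dec-false.
  g0-from-< : ∀ s Q x → x < s → g0-from n T s Q x ≡ inj₁ (T x)
  g0-from-< s [] x x<s = refl
  g0-from-< s (chr ∷ ps) x x<s
    rewrite dec-false (x ≟ s) (<⇒≢ x<s) = g0-from-< (suc s) ps x (≤-trans x<s (n≤1+n s))
  g0-from-< s (tgt t len ∷ ps) x x<s
    rewrite dec-false (s ≤? x) (<⇒≱ x<s) = g0-from-< (s + len) ps x (<-≤-trans x<s (m≤m+n s len))

  g0-from-++ˡ : ∀ s P Q x → x < nextPos n T s P →
                g0-from n T s (P ++ Q) x ≡ g0-from n T s P x
  g0-from-++ˡ s [] Q x x<s = g0-from-< s Q x x<s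
  g0-from-++ˡ s (chr ∷ ps) Q x x<m with x ≟ s
  ... | yes x≡s rewrite dec-true (x ≟ s) x≡s = refl
  ... | no x≢s rewrite dec-false (x ≟ s) x≢s = g0-from-++ˡ (suc s) ps Q x x<m
  g0-from-++ˡ s (tgt t len ∷ ps) Q x x<m with s ≤? x
  ... | no s≰x rewrite dec-false (s ≤? x) s≰x = g0-from-++ˡ (s + len) ps Q x x<m
  ... | yes s≤x rewrite dec-true (s ≤? x) s≤x with x <? s + len
  ...   | yes x<e rewrite dec-true (x <? s + len) x<e = refl
  ...   | no x≮e rewrite dec-false (x <? s + len) x≮e = g0-from-++ˡ (s + len) ps Q x x<m

  g0-from-++ʳ : ∀ s P Q x → nextPos n T s P ≤ x →
                g0-from n T s (P ++ Q) x ≡ g0-from n T (nextPos n T s P) Q x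
  g0-from-++ʳ s [] Q x m≤x = refl
  g0-from-++ʳ s (chr ∷ ps) Q x m≤x
    rewrite dec-false (x ≟ s) (>⇒≢ (≤-trans (s≤nextPos (suc s) ps) m≤x))
    = g0-from-++ʳ (suc s) ps Q x m≤x
  g0-from-++ʳ s (tgt t len ∷ ps) Q x m≤x
    rewrite dec-false (x <? s + len) (≤⇒≯ (≤-trans (s≤nextPos (s + len) ps) m≤x))
          | ∧-zeroʳ (does (s ≤? x))
    = g0-from-++ʳ (s + len) ps Q x m≤x

  g0-follow≤ : ∀ P x → follow n T P ≤ x → g0 n T P x ≡ inj₁ (T x)
  g0-follow≤ P x i≤x =
    subst (λ R → g0-from n T 1 R x ≡ inj₁ (T x)) (++-identityʳ P) (g0-from-++ʳ 1 P [] x i≤x)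

  g0-pointer-< : ∀ P x y → g0 n T P x ≡ inj₂ y → x < follow n T P
  g0-pointer-< P x y e with x <? follow n T P
  ... | yes x<i = x<i
  ... | no x≮i with trans (sym (g0-follow≤ P x (≮⇒≥ x≮i))) e
  ...   | ()

  step : List Phrase → A ⊎ ℕ → A ⊎ ℕ
  step R (inj₁ c) = inj₁ c
  step R (inj₂ y) = g0 n T R y

  g-suc : ∀ R k x → g n T R (suc k) x ≡ step R (g n T R k x)
  g-suc R k x with g n T R k x
  ... | inj₁ _ = refl
  ... | inj₂ _ = refl

  IsChar-g-suc : ∀ R k x → IC (g n T R k x) → IC (g n T R (suc k) x)
  IsChar-g-suc R k x c with g n T R k x
  ... | inj₁ _ = tt

  IsChar-g-+ : ∀ R a b x → IC (g n T R a x) → IC (g n T R (b + a) x)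
  IsChar-g-+ R a zero x c = c
  IsChar-g-+ R a (suc b) x c = IsChar-g-suc R (b + a) x (IsChar-g-+ R a b x c)

  IsChar-g-mono : ∀ R {a b} x → a ≤ b → IC (g n T R a x) → IC (g n T R b x)
  IsChar-g-mono R {a} {b} x a≤b c =
    subst (λ k → IC (g n T R k x)) (m∸n+n≡m a≤b) (IsChar-g-+ R a (b ∸ a) x c)

  g-shift : ∀ R k x y → g n T R k x ≡ inj₂ y →
            ∀ m → g n T R (m + suc k) x ≡ g n T R m y
  g-shift R k x y e zero = trans (g-suc R k x) (cong (step R) e)
  g-shift R k x y e (suc m) = begin
    g n T R (suc (m + suc k)) x   ≡⟨ g-suc R (m + suc k) x ⟩
    step R (g n T R (m + suc k) x) ≡⟨ cong (step R) (g-shift R k x y e m) ⟩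
    step R (g n T R m y)           ≡⟨ sym (g-suc R m y) ⟩
    g n T R (suc m) y              ∎
    where open ≡-Reasoning

  Source-pointer : ∀ R k x y → g n T R k x ≡ inj₂ y → ¬ IC (g0 n T R y) →
                   ∀ z → Source n T R y z ⇔ Source n T R x z
  Source-pointer R k x y e y-pointer z = mk⇔ to from
    where
    pointer-at-k : ∀ m → m ≤ k → ¬ IC (g n T R m x)
    pointer-at-k m m≤k c = subst IC e (IsChar-g-mono R x m≤k c)

    to : Source n T R y z → Source n T R x z
    to (inj₁ (c , _)) = ⊥-elim (y-pointer c)
    to (inj₂ (m , em , cm)) =
      inj₂ (m + suc k , trans (g-shift R k x y e m) em
                      , subst IC (sym (g-shift R k x y e (suc m))) cm)

    from : Source n T R x z → Source n T R y z
    from (inj₁ (c , _)) = ⊥-elim (pointer-at-k 0 z≤n c)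
    from (inj₂ (m , em , cm)) with <-cmp m k
    ... | tri< m<k _ _ = ⊥-elim (pointer-at-k (suc m) m<k cm)
    ... | tri≈ _ refl _ = ⊥-elim (y-pointer (subst IC (g-shift R k x y e 0) cm))
    ... | tri> _ _ k<m with m ∸ suc k | m∸n+n≡m k<m
    ...   | d | refl = inj₂ (d , trans (sym (g-shift R k x y e d)) em
                               , subst IC (g-shift R k x y e (suc d)) cm)

  module Append (P : List Phrase) (j ℓ : ℕ) where

    private
      P' = append n T P j ℓ
      i = follow n T P

    InNewPhrase : ℕ → Set
    InNewPhrase x = i ≤ x × x < i + ℓ

    g0-append-inside : ∀ x → InNewPhrase x → g0 n T P' x ≡ inj₂ (j + (x ∸ i))
    g0-append-inside x (i≤x , x<i+ℓ)
      rewrite g0-from-++ʳ 1 P [ tgt j ℓ ] x i≤x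
            | dec-true (i ≤? x) i≤x | dec-true (x <? i + ℓ) x<i+ℓ = refl

    g0-append-outside : ∀ x → ¬ InNewPhrase x → g0 n T P' x ≡ g0 n T P x
    g0-append-outside x out with x <? i
    ... | yes x<i = g0-from-++ˡ 1 P [ tgt j ℓ ] x x<i
    ... | no x≮i with ≮⇒≥ x≮i
    ...   | i≤x rewrite g0-from-++ʳ 1 P [ tgt j ℓ ] x i≤x
                      | dec-true (i ≤? x) i≤x
                      | dec-false (x <? i + ℓ) (λ x<i+ℓ → out (i≤x , x<i+ℓ))
      = sym (g0-follow≤ P x i≤x)

    g0-append-pointer : ∀ x y → g0 n T P x ≡ inj₂ y → g0 n T P' x ≡ inj₂ y
    g0-append-pointer x y e =
      trans (g0-from-++ˡ 1 P [ tgt j ℓ ] x (g0-pointer-< P x y e)) e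

    g-append-pointer : ∀ k x y → g n T P k x ≡ inj₂ y → g n T P' k x ≡ inj₂ y
    g-append-pointer zero x y e = g0-append-pointer x y e
    g-append-pointer (suc k) x y e with g n T P k x in ek
    ... | inj₂ v = trans (g-suc P' k x)
                   (trans (cong (step P') (g-append-pointer k x v ek)) (g0-append-pointer v y e))

    Source-append-outside : ∀ x y → Source n T P x y → ¬ InNewPhrase y →
                            Source n T P' x y
    Source-append-outside x y (inj₁ (c , refl)) out =
      inj₁ (subst IC (sym (g0-append-outside x out)) c , refl)
    Source-append-outside x y (inj₂ (k , e , c)) out =
      inj₂ (k , e' , subst IC (sym same-next) c)
      where
      e' = g-append-pointer k x y e
      same-next : g n T P' (suc k) x ≡ g n T P (suc k) x
      same-next = begin
        g n T P' (suc k) x       ≡⟨ g-suc P' k x ⟩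
        step P' (g n T P' k x)   ≡⟨ cong (step P') e' ⟩
        g0 n T P' y              ≡⟨ g0-append-outside y out ⟩
        g0 n T P y               ≡⟨ cong (step P) e ⟨
        step P (g n T P k x)     ≡⟨ g-suc P k x ⟨
        g n T P (suc k) x        ∎
        where open ≡-Reasoning

    Source-append-inside : ∀ x y → Source n T P x y → InNewPhrase y →
                           ∀ z → Source n T P' y z ⇔ Source n T P' x z
    Source-append-inside x .x (inj₁ (_ , refl)) _ z = mk⇔ id id
    Source-append-inside x y (inj₂ (k , e , _)) inside =
      Source-pointer P' k x y (g-append-pointer k x y e)
        (λ c → subst IC (g0-append-inside y inside) c)

lemma3 : {A : Set} (n : ℕ) (T : ℕ → A) (P : List Phrase) (j ℓ : ℕ)
    → Valid n T P
    → 1 ≤ j → j ≤ n → 1 ≤ ℓ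
    → Valid n T (append n T P j ℓ)
    → (x : ℕ) → 1 ≤ x → x ≤ n
    → (y : ℕ) → Source n T P x y
    → (¬ (follow n T P ≤ y × y < follow n T P + ℓ)
    → Source n T (append n T P j ℓ) x y)
    × ((follow n T P ≤ y × y < follow n T P + ℓ)
    → ∀ z → Source n T (append n T P j ℓ) y z
    ⇔ Source n T (append n T P j ℓ) x z)
lemma3 n T P j ℓ _ _ _ _ _ x _ _ y src =
  Source-append-outside x y src , Source-append-inside x y src
  where open Append n T P j ℓ
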